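{- Let $n\ge 2$ and $1\le k\le n-1$, let $B_0=\{0,1,\ldots,k-1\}\subseteq\mathbb{Z}_n$ and $B_0^C=\mathbb{Z}_n\setminus B_0$. Let $A=(B_0\setminus Q)\cup P$, where $Q\subseteq B_0$ and $P\subseteq B_0^C$ with $|Q|=|P|$. Then $|\mathrm{Stab}(A)|\le 2|Q|+1$.
   Context: $\mathbb{Z}_n$ acts on subsets of $\mathbb{Z}_n$ by $A+s=\{a+s:a\in A\}$ (modulo $n$), and $\mathrm{Stab}(A)=\{s\in\mathbb{Z}_n:A+s=A\}$. -}

module Defs where

open import Data.Nat using (ℕ; _+_; _∸_; NonZero; _<_)
open import Data.Nat.DivMod using (_mod_)
open import Data.Bool using (Bool; true; false)
open import Data.Bool.Properties renaming (_≟_ to _≟ᵇ_)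
open import Data.Fin using (Fin; toℕ)
open import Data.Fin.Subset using (Subset; ∁)
open import Data.Vec using (lookup; tabulate)
open import Data.Vec.Properties using (≡-dec)
open import Relation.Nullary using (does)

_+ₙ_ : ∀ {n} .{{_ : NonZero n}} → Fin n → Fin n → Fin n
_+ₙ_ {n} a s = (toℕ a + toℕ s) mod n

-ₙ_ : ∀ {n} .{{_ : NonZero n}} → Fin n → Fin n
-ₙ_ {n} s = (n ∸ toℕ s) mod n

translate : ∀ {n} .{{_ : NonZero n}} → Subset n → Fin n → Subset n
translate A s = tabulate (λ x → lookup A (x +ₙ (-ₙ s)))

Stab : ∀ {n} .{{_ : NonZero n}} → Subset n → Subset n
Stab A = tabulate (λ s → does (≡-dec _≟ᵇ_ (translate A s) A))

B₀ : ∀ {n} → ℕ → Subset n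
B₀ k = tabulate (λ x → does (Data.Nat._<?_ (toℕ x) k))
  where import Data.Nat

{-# OPTIONS --safe #-}

-- Let S = Stab A. As |Q| = |P| and 1 ≤ k ≤ n − 1, the set A is neither empty nor all of ℤₙ, so
-- walking around ℤₙ in steps of 1 meets a boundary point u: exactly one of u, u + 1 lies in A.
-- Since A + s = A for s ∈ S, A is constant on T = u − S, and likewise on T + 1 = (u + 1) − S;
-- hence one of T, T + 1 lies in A and the other in its complement. The part of the former outside
-- B₀ lies in P, the part of the latter inside B₀ lies in Q, and because B₀ is an interval,
-- translating by 1 changes |T ∩ B₀| by at most one. So |S| = |T| ≤ |P| + |Q| + 1 = 2|Q| + 1.

module Submission where

open import Defs
open import Algebra.Bundles using (AbelianGroup)
import Algebra.Properties.AbelianGroup as AbelianGroupProperties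
import Algebra.Properties.CommutativeMonoid.Sum as CommutativeMonoidSum
open import Data.Bool using (Bool; true; false; _∧_; _∨_; not)
open import Data.Bool.Properties using (∧-conicalˡ; ∧-conicalʳ; ∨-zeroʳ; ∨-identityʳ; ∧-zeroʳ; ¬-not; ∧-identityʳ; not-injective)
  renaming (_≟_ to _≟ᵇ_)
open import Data.Fin using (Fin; zero; suc; toℕ)
open import Data.Fin.Permutation using (permutation)
open import Data.Fin.Properties using (toℕ-fromℕ<; toℕ-injective; toℕ<n; ¬∀⟶∃¬)
open import Data.Fin.Subset using (Subset; _⊆_; _∪_; _─_; ∁; ∣_∣)
open import Data.Nat using (ℕ; zero; suc; pred; _+_; _*_; _∸_; _%_; _≤_; _<_; z≤n; s≤s; _<?_; NonZero; >-nonZero⁻¹)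
open import Data.Nat.DivMod using (_mod_; %-distribˡ-+; m%n%n≡m%n; m<n⇒m%n≡m; n%n≡0; m%n≤m)
open import Data.Nat.Properties
  using (+-comm; +-assoc; +-suc; +-identityʳ; m+[n∸m]≡n; <⇒≤; ≤-refl; ≤-trans; ≤-reflexive; ≤-<-trans;
         +-mono-≤; m≤n+m; m≤n⇒m<n∨m≡n; <-irrefl; +-0-commutativeMonoid; module ≤-Reasoning)
open import Data.Product using (∃; _,_; proj₂)
open import Data.Sum using (_⊎_; inj₁; inj₂; [_,_]′; map₁; map₂)
open import Data.Vec using ([]; _∷_; lookup)
open import Data.Vec.Properties using (lookup∘tabulate; lookup-zipWith; lookup-map; []=⇒lookup; lookup⇒[]=; ≡-dec)
open import Function using (_∘_; id)
open import Relation.Binary.PropositionalEquality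
open import Relation.Nullary using (Dec; yes; does; ¬_; contradiction)
open import Relation.Nullary.Decidable using (dec-true; dec-false)

open CommutativeMonoidSum +-0-commutativeMonoid using (sum; sum-cong-≗; sum-permute)

χ : Bool → ℕ
χ true  = 1
χ false = 0

count : ∀ {n} → (Fin n → Bool) → ℕ
count f = sum (χ ∘ f)

infixr 7 _∩_ _∖_

_∩_ _∖_ : ∀ {n} → (Fin n → Bool) → (Fin n → Bool) → Fin n → Bool
(f ∩ g) i = f i ∧ g i
(f ∖ g) i = f i ∧ not (g i)

∣p∣≡count-lookup : ∀ {n} (p : Subset n) → ∣ p ∣ ≡ count (lookup p)
∣p∣≡count-lookup []          = refl
∣p∣≡count-lookup (true ∷ p)  = cong suc (∣p∣≡count-lookup p)
∣p∣≡count-lookup (false ∷ p) = ∣p∣≡count-lookup p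

count-cong : ∀ {n} {f g : Fin n → Bool} → f ≗ g → count f ≡ count g
count-cong f≗g = sum-cong-≗ (cong χ ∘ f≗g)

count-∘-bijection : ∀ {n} (f : Fin n → Bool) (π π⁻¹ : Fin n → Fin n) →
                    (∀ i → π (π⁻¹ i) ≡ i) → (∀ i → π⁻¹ (π i) ≡ i) → count (f ∘ π) ≡ count f
count-∘-bijection f π π⁻¹ π∘π⁻¹ π⁻¹∘π = sym (sum-permute (χ ∘ f) (permutation π π⁻¹ π∘π⁻¹ π⁻¹∘π))

χ-mono : ∀ {a b} → (a ≡ true → b ≡ true) → χ a ≤ χ b
χ-mono {false} _   = z≤n
χ-mono {true}  a⇒b rewrite a⇒b refl = ≤-refl

χ≤1 : ∀ b → χ b ≤ 1
χ≤1 true  = ≤-refl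
χ≤1 false = z≤n

count-mono : ∀ {n} {f g : Fin n → Bool} → (∀ i → f i ≡ true → g i ≡ true) → count f ≤ count g
count-mono {zero}  _   = z≤n
count-mono {suc n} f⊆g = +-mono-≤ (χ-mono (f⊆g zero)) (count-mono (f⊆g ∘ suc))

count-mono-except : ∀ {n} {f g : Fin n → Bool} c →
                    (∀ i → f i ≡ true → g i ≡ true ⊎ toℕ i ≡ c) → count f ≤ suc (count g)
count-mono-except {zero}            _       _   = z≤n
count-mono-except {suc n} {f} {g} zero    f⊆g =
  +-mono-≤ (χ≤1 (f zero)) (≤-trans (count-mono f∘suc⊆g∘suc) (m≤n+m _ (χ (g zero))))
  where
  f∘suc⊆g∘suc : ∀ i → f (suc i) ≡ true → g (suc i) ≡ true
  f∘suc⊆g∘suc i fi = [ id , (λ ()) ]′ (f⊆g (suc i) fi)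
count-mono-except {suc n} {f} {g} (suc c) f⊆g =
  ≤-trans (+-mono-≤ (χ-mono (λ f0 → [ id , (λ ()) ]′ (f⊆g zero f0)))
                    (count-mono-except c (λ i fi → map₂ (cong pred) (f⊆g (suc i) fi))))
          (≤-reflexive (+-suc (χ (g zero)) _))

count-∩-mono-except : ∀ {n} {f g h : Fin n → Bool} c →
                      (∀ i → g i ≡ true → h i ≡ true ⊎ toℕ i ≡ c) → count (f ∩ g) ≤ suc (count (f ∩ h))
count-∩-mono-except {f = f} {g} c g⊆h = count-mono-except c λ i fgi →
  map₁ (cong₂ _∧_ (∧-conicalˡ (f i) (g i) fgi)) (g⊆h i (∧-conicalʳ (f i) (g i) fgi))

count-split : ∀ {n} (f h : Fin n → Bool) → count f ≡ count (f ∩ h) + count (f ∖ h)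
count-split {zero}  f h = refl
count-split {suc n} f h with f zero | h zero | count-split (f ∘ suc) (h ∘ suc)
... | false | _     | eq = eq
... | true  | true  | eq = cong suc eq
... | true  | false | eq = trans (cong suc eq) (sym (+-suc _ _))

count-witness : ∀ {n} {f : Fin n → Bool} i → f i ≡ true → 0 < count f
count-witness {f = f} zero    f0 rewrite f0 = s≤s z≤n
count-witness {f = f} (suc i) fi = ≤-trans (count-witness i fi) (m≤n+m _ (χ (f zero)))

count-witness⁻¹ : ∀ {n} (f : Fin n → Bool) → 0 < count f → ∃ λ i → f i ≡ true
count-witness⁻¹ {suc n} f pos with f zero in f0
... | true  = zero , f0
... | false = let (i , fi) = count-witness⁻¹ (f ∘ suc) pos in suc i , fi

lookup-─ : ∀ {n} (p q : Subset n) i → lookup (p ─ q) i ≡ lookup p i ∧ not (lookup q i)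
lookup-─ (x ∷ _) (true  ∷ _) zero    = sym (∧-zeroʳ x)
lookup-─ (x ∷ _) (false ∷ _) zero    = sym (∧-identityʳ x)
lookup-─ (_ ∷ p) (_     ∷ q) (suc i) = lookup-─ p q i

lookup-⊆ : ∀ {n} {p q : Subset n} → p ⊆ q → ∀ i → lookup p i ≡ true → lookup q i ≡ true
lookup-⊆ {p = p} p⊆q i pi = []=⇒lookup (p⊆q (lookup⇒[]= i p pi))

lookup-⊆∁ : ∀ {n} {p q : Subset n} → p ⊆ ∁ q → ∀ i → lookup p i ≡ true → lookup q i ≡ false
lookup-⊆∁ {q = q} p⊆∁q i pi = not-injective (trans (sym (lookup-map i not q)) (lookup-⊆ p⊆∁q i pi))

does⇒ : ∀ {a} {A : Set a} (a? : Dec A) → does a? ≡ true → A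
does⇒ (yes a) _ = a

lookup-B₀ : ∀ {n} k (y : Fin n) → lookup (B₀ k) y ≡ does (toℕ y <? k)
lookup-B₀ k = lookup∘tabulate _

∈B₀⇒< : ∀ {n k} {y : Fin n} → lookup (B₀ k) y ≡ true → toℕ y < k
∈B₀⇒< {k = k} {y} y∈B₀ = does⇒ (toℕ y <? k) (trans (sym (lookup-B₀ k y)) y∈B₀)

<⇒∈B₀ : ∀ {n k} {y : Fin n} → toℕ y < k → lookup (B₀ k) y ≡ true
<⇒∈B₀ {k = k} {y} y<k = trans (lookup-B₀ k y) (dec-true (toℕ y <? k) y<k)

≮⇒∉B₀ : ∀ {n k} {y : Fin n} → ¬ toℕ y < k → lookup (B₀ k) y ≡ false
≮⇒∉B₀ {k = k} {y} y≮k = trans (lookup-B₀ k y) (dec-false (toℕ y <? k) y≮k)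

module Exchange {n} (B Q P : Fin n → Bool) where

  A : Fin n → Bool
  A i = (B i ∧ not (Q i)) ∨ P i

  A∖B⊆P : ∀ i → A i ≡ true → B i ≡ false → P i ≡ true
  A∖B⊆P i Ai Bi rewrite Bi = Ai

  B∖A⊆Q : ∀ i → A i ≡ false → B i ≡ true → Q i ≡ true
  B∖A⊆Q i Ai Bi with B i | Q i
  ... | _     | true  = refl
  ... | true  | false = contradiction Ai λ ()
  ... | false | false = contradiction Bi λ ()

  P⊆A : ∀ i → P i ≡ true → A i ≡ true
  P⊆A i Pi rewrite Pi = ∨-zeroʳ _

  Q∖P⊆∁A : ∀ i → Q i ≡ true → P i ≡ false → A i ≡ false
  Q∖P⊆∁A i Qi Pi rewrite Qi | Pi = trans (∨-identityʳ _) (∧-zeroʳ (B i))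

  count≤1+count-Q+count-P : (X Y : Fin n → Bool) →
                (∀ i → X i ≡ true → A i ≡ true) → (∀ i → Y i ≡ true → A i ≡ false) →
                count (X ∩ B) ≤ suc (count (Y ∩ B)) → count X ≤ suc (count Q + count P)
  count≤1+count-Q+count-P X Y X⊆A Y⊆∁A X∩B≤ = begin
    count X                        ≡⟨ count-split X B ⟩
    count (X ∩ B) + count (X ∖ B)  ≤⟨ +-mono-≤ (≤-trans X∩B≤ (s≤s (count-mono Y∩B⊆Q))) (count-mono X∖B⊆P) ⟩
    suc (count Q) + count P        ∎
    where
    open ≤-Reasoning
    X∖B⊆P : ∀ i → (X ∖ B) i ≡ true → P i ≡ true
    X∖B⊆P i e = A∖B⊆P i (X⊆A i (∧-conicalˡ _ _ e)) (not-injective (∧-conicalʳ _ _ e))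
    Y∩B⊆Q : ∀ i → (Y ∩ B) i ≡ true → Q i ≡ true
    Y∩B⊆Q i e = B∖A⊆Q i (Y⊆∁A i (∧-conicalˡ _ _ e)) (∧-conicalʳ _ _ e)

  A-nonempty : ∀ i → B i ≡ true → count Q ≡ count P → ∃ λ x → A x ≡ true
  A-nonempty i Bi |Q|≡|P| with A i in Ai
  ... | true  = i , Ai
  ... | false =
    let (j , Pj) = count-witness⁻¹ P (subst (0 <_) |Q|≡|P| (count-witness i (B∖A⊆Q i Ai Bi)))
    in  j , P⊆A j Pj

  A-nonfull : ∀ i → B i ≡ false →
              (∀ j → Q j ≡ true → B j ≡ true) → (∀ j → P j ≡ true → B j ≡ false) →
              count Q ≡ count P → ∃ λ y → A y ≡ false
  A-nonfull i Bi Q⊆B P⊆∁B |Q|≡|P| with A i in Ai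
  ... | false = i , Ai
  ... | true  =
    let (j , Qj) = count-witness⁻¹ Q (subst (0 <_) (sym |Q|≡|P|) (count-witness i (A∖B⊆P i Ai Bi)))
    in  j , Q∖P⊆∁A j Qj (¬-not λ Pj → contradiction (trans (sym (Q⊆B j Qj)) (P⊆∁B j Pj)) λ ())

lookup-─∪ : ∀ {n} (b q p : Subset n) → lookup ((b ─ q) ∪ p) ≗ Exchange.A (lookup b) (lookup q) (lookup p)
lookup-─∪ b q p i = trans (lookup-zipWith _∨_ i (b ─ q) p) (cong (_∨ lookup p i) (lookup-─ b q i))

%-absorbˡ : ∀ a b d .{{_ : NonZero d}} → (a % d + b) % d ≡ (a + b) % d
%-absorbˡ a b d = begin
  (a % d + b) % d          ≡⟨ %-distribˡ-+ (a % d) b d ⟩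
  (a % d % d + b % d) % d  ≡⟨ cong (λ r → (r + b % d) % d) (m%n%n≡m%n a d) ⟩
  (a % d + b % d) % d      ≡⟨ %-distribˡ-+ a b d ⟨
  (a + b) % d              ∎
  where open ≡-Reasoning

%-absorbʳ : ∀ a b d .{{_ : NonZero d}} → (a + b % d) % d ≡ (a + b) % d
%-absorbʳ a b d = begin
  (a + b % d) % d  ≡⟨ cong (_% d) (+-comm a (b % d)) ⟩
  (b % d + a) % d  ≡⟨ %-absorbˡ b a d ⟩
  (b + a) % d      ≡⟨ cong (_% d) (+-comm b a) ⟩
  (a + b) % d      ∎
  where open ≡-Reasoning

module ℤₙ (n : ℕ) .{{_ : NonZero n}} where

  0ₙ 1ₙ : Fin n
  0ₙ = 0 mod n
  1ₙ = 1 mod n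

  toℕ-mod : ∀ a → toℕ (a mod n) ≡ a % n
  toℕ-mod a = toℕ-fromℕ< _

  toℕ-mod-< : ∀ {a} → a < n → toℕ (a mod n) ≡ a
  toℕ-mod-< {a} a<n = trans (toℕ-mod a) (m<n⇒m%n≡m a<n)

  mod-toℕ : ∀ x → toℕ x mod n ≡ x
  mod-toℕ x = toℕ-injective (trans (toℕ-mod (toℕ x)) (m<n⇒m%n≡m (toℕ<n x)))

  mod-cong : ∀ {a b} → a % n ≡ b % n → a mod n ≡ b mod n
  mod-cong eq = toℕ-injective (trans (toℕ-mod _) (trans eq (sym (toℕ-mod _))))

  +ₙ-homo : ∀ a b → (a mod n) +ₙ (b mod n) ≡ (a + b) mod n
  +ₙ-homo a b = mod-cong (begin
    (toℕ (a mod n) + toℕ (b mod n)) % n  ≡⟨ cong₂ (λ r s → (r + s) % n) (toℕ-mod a) (toℕ-mod b) ⟩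
    (a % n + b % n) % n                  ≡⟨ %-absorbˡ a (b % n) n ⟩
    (a + b % n) % n                      ≡⟨ %-absorbʳ a b n ⟩
    (a + b) % n                          ∎)
    where open ≡-Reasoning

  +ₙ-comm : ∀ x y → x +ₙ y ≡ y +ₙ x
  +ₙ-comm x y = cong (_mod n) (+-comm (toℕ x) (toℕ y))

  +ₙ-assoc : ∀ x y z → (x +ₙ y) +ₙ z ≡ x +ₙ (y +ₙ z)
  +ₙ-assoc x y z = begin
    (x +ₙ y) +ₙ z                             ≡⟨ cong (((toℕ x + toℕ y) mod n) +ₙ_) (mod-toℕ z) ⟨
    ((toℕ x + toℕ y) mod n) +ₙ (toℕ z mod n)  ≡⟨ +ₙ-homo (toℕ x + toℕ y) (toℕ z) ⟩
    (toℕ x + toℕ y + toℕ z) mod n             ≡⟨ cong (_mod n) (+-assoc (toℕ x) (toℕ y) (toℕ z)) ⟩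
    (toℕ x + (toℕ y + toℕ z)) mod n           ≡⟨ +ₙ-homo (toℕ x) (toℕ y + toℕ z) ⟨
    (toℕ x mod n) +ₙ (y +ₙ z)                 ≡⟨ cong (_+ₙ (y +ₙ z)) (mod-toℕ x) ⟩
    x +ₙ (y +ₙ z)                             ∎
    where open ≡-Reasoning

  +ₙ-identityʳ : ∀ x → x +ₙ 0ₙ ≡ x
  +ₙ-identityʳ x = begin
    x +ₙ 0ₙ                ≡⟨ cong (_+ₙ 0ₙ) (mod-toℕ x) ⟨
    (toℕ x mod n) +ₙ 0ₙ    ≡⟨ +ₙ-homo (toℕ x) 0 ⟩
    (toℕ x + 0) mod n      ≡⟨ cong (_mod n) (+-identityʳ (toℕ x)) ⟩
    toℕ x mod n            ≡⟨ mod-toℕ x ⟩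
    x                      ∎
    where open ≡-Reasoning

  +ₙ-inverseʳ : ∀ x → x +ₙ (-ₙ x) ≡ 0ₙ
  +ₙ-inverseʳ x = begin
    x +ₙ (-ₙ x)                    ≡⟨ cong (_+ₙ (-ₙ x)) (mod-toℕ x) ⟨
    (toℕ x mod n) +ₙ (-ₙ x)        ≡⟨ +ₙ-homo (toℕ x) (n ∸ toℕ x) ⟩
    (toℕ x + (n ∸ toℕ x)) mod n    ≡⟨ cong (_mod n) (m+[n∸m]≡n (<⇒≤ (toℕ<n x))) ⟩
    n mod n                        ≡⟨ mod-cong (trans (n%n≡0 n) (sym (m<n⇒m%n≡m (>-nonZero⁻¹ n)))) ⟩
    0ₙ                             ∎
    where open ≡-Reasoning

  +ₙ-abelianGroup : AbelianGroup _ _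
  +ₙ-abelianGroup = record
    { isAbelianGroup = record
      { isGroup = record
        { isMonoid = record
          { isSemigroup = record
            { isMagma  = record { isEquivalence = isEquivalence ; ∙-cong = cong₂ _+ₙ_ }
            ; assoc    = +ₙ-assoc
            }
          ; identity = (λ x → trans (+ₙ-comm 0ₙ x) (+ₙ-identityʳ x)) , +ₙ-identityʳ
          }
        ; inverse = (λ x → trans (+ₙ-comm (-ₙ x) x) (+ₙ-inverseʳ x)) , +ₙ-inverseʳ
        ; ⁻¹-cong = cong -ₙ_
        }
      ; comm = +ₙ-comm
      }
    }

  open AbelianGroup +ₙ-abelianGroup using (assoc)
  open AbelianGroupProperties +ₙ-abelianGroup using (//-rightDividesˡ; //-rightDividesʳ; ⁻¹-anti-homo-//; xyx⁻¹≈y)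

  infixl 6 _-ₙ_
  _-ₙ_ : Fin n → Fin n → Fin n
  x -ₙ y = x +ₙ (-ₙ y)

  -ₙ-involutive : ∀ u y → u -ₙ (u -ₙ y) ≡ y
  -ₙ-involutive u y = begin
    u +ₙ (-ₙ (u -ₙ y))   ≡⟨ cong (u +ₙ_) (⁻¹-anti-homo-// u y) ⟩
    u +ₙ (y -ₙ u)        ≡⟨ assoc u y (-ₙ u) ⟨
    u +ₙ y -ₙ u          ≡⟨ xyx⁻¹≈y u y ⟩
    y                    ∎
    where open ≡-Reasoning

  +ₙ-minus : ∀ u s y → (u +ₙ s) -ₙ y ≡ u -ₙ (y -ₙ s)
  +ₙ-minus u s y = begin
    (u +ₙ s) -ₙ y        ≡⟨ assoc u s (-ₙ y) ⟩
    u +ₙ (s -ₙ y)        ≡⟨ cong (u +ₙ_) (⁻¹-anti-homo-// y s) ⟨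
    u -ₙ (y -ₙ s)        ∎
    where open ≡-Reasoning

  suc-mod : ∀ j → suc j mod n ≡ (j mod n) +ₙ 1ₙ
  suc-mod j = trans (cong (_mod n) (+-comm 1 j)) (sym (+ₙ-homo j 1))

  +1-invariant⇒constant : ∀ {a} {A : Set a} (f : Fin n → A) →
                          (∀ x → f x ≡ f (x +ₙ 1ₙ)) → ∀ x → f x ≡ f 0ₙ
  +1-invariant⇒constant f f-inv x = trans (cong f (sym (mod-toℕ x))) (walk (toℕ x))
    where
    walk : ∀ j → f (j mod n) ≡ f 0ₙ
    walk zero    = refl
    walk (suc j) = trans (cong f (suc-mod j)) (trans (sym (f-inv (j mod n))) (walk j))

  boundary : (f : Fin n → Bool) → ∀ {x y} → f x ≡ true → f y ≡ false → ∃ λ u → f u ≢ f (u +ₙ 1ₙ)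
  boundary f {x} {y} fx fy = ¬∀⟶∃¬ n _ (λ u → f u ≟ᵇ f (u +ₙ 1ₙ)) λ f-inv →
    contradiction (begin
      true  ≡⟨ fx ⟨
      f x   ≡⟨ +1-invariant⇒constant f f-inv x ⟩
      f 0ₙ  ≡⟨ +1-invariant⇒constant f f-inv y ⟨
      f y   ≡⟨ fy ⟩
      false ∎) λ ()
    where open ≡-Reasoning

  -- Subsets of ℤₙ as Boolean predicates: X +ₚ s is the translate X + s, and u -ₚ S is {u − s : s ∈ S}.
  infixl 6 _+ₚ_
  _+ₚ_ : (Fin n → Bool) → Fin n → Fin n → Bool
  (X +ₚ s) y = X (y -ₙ s)

  _-ₚ_ : Fin n → (Fin n → Bool) → Fin n → Bool
  (u -ₚ S) y = S (u -ₙ y)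

  count-+ₚ : ∀ X s → count (X +ₚ s) ≡ count X
  count-+ₚ X s = count-∘-bijection X (_-ₙ s) (_+ₙ s) (//-rightDividesʳ s) (//-rightDividesˡ s)

  count--ₚ : ∀ u S → count (u -ₚ S) ≡ count S
  count--ₚ u S = count-∘-bijection S (λ y → u -ₙ y) (λ y → u -ₙ y) (-ₙ-involutive u) (-ₙ-involutive u)

  -ₚ-+ₙ : ∀ u s S → (u +ₙ s) -ₚ S ≗ (u -ₚ S) +ₚ s
  -ₚ-+ₙ u s S y = cong S (+ₙ-minus u s y)

  count-+ₚ-∩ : ∀ X B s → count ((X +ₚ s) ∩ B) ≡ count (X ∩ (B ∘ (_+ₙ s)))
  count-+ₚ-∩ X B s = trans (count-cong λ y → cong (λ z → X (y -ₙ s) ∧ B z) (sym (//-rightDividesˡ s y)))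
                           (count-+ₚ (X ∩ (B ∘ (_+ₙ s))) s)

  toℕ-+ₙ1ₙ : ∀ y → toℕ (y +ₙ 1ₙ) ≡ suc (toℕ y) % n
  toℕ-+ₙ1ₙ y = begin
    toℕ (y +ₙ 1ₙ)              ≡⟨ cong (λ z → toℕ (z +ₙ 1ₙ)) (mod-toℕ y) ⟨
    toℕ ((toℕ y mod n) +ₙ 1ₙ)  ≡⟨ cong toℕ (suc-mod (toℕ y)) ⟨
    toℕ (suc (toℕ y) mod n)    ≡⟨ toℕ-mod (suc (toℕ y)) ⟩
    suc (toℕ y) % n            ∎
    where open ≡-Reasoning

  B₀-+1 : ∀ {k y} → lookup (B₀ k) y ≡ true → lookup (B₀ k) (y +ₙ 1ₙ) ≡ true ⊎ toℕ y ≡ pred k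
  B₀-+1 {k} {y} y∈B₀ with m≤n⇒m<n∨m≡n (∈B₀⇒< y∈B₀)
  ... | inj₁ 1+y<k = inj₁ (<⇒∈B₀ {k = k} (≤-<-trans (≤-trans (≤-reflexive (toℕ-+ₙ1ₙ y)) (m%n≤m _ n)) 1+y<k))
  ... | inj₂ 1+y≡k = inj₂ (cong pred 1+y≡k)

  B₀-+1⁻ : ∀ {k y} → lookup (B₀ k) (y +ₙ 1ₙ) ≡ true → lookup (B₀ k) y ≡ true ⊎ toℕ y ≡ pred n
  B₀-+1⁻ {k} {y} y+1∈B₀ with m≤n⇒m<n∨m≡n (toℕ<n y)
  ... | inj₁ 1+y<n = inj₁ (<⇒∈B₀ {k = k} (<⇒≤ (subst (_< k) (trans (toℕ-+ₙ1ₙ y) (m<n⇒m%n≡m 1+y<n)) (∈B₀⇒< y+1∈B₀))))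
  ... | inj₂ 1+y≡n = inj₂ (cong pred 1+y≡n)

  0ₙ∈B₀ : ∀ {k} → 0 < k → lookup (B₀ k) 0ₙ ≡ true
  0ₙ∈B₀ {k} 0<k = <⇒∈B₀ {y = 0ₙ} (subst (_< k) (sym (toℕ-mod-< (>-nonZero⁻¹ n))) 0<k)

  k∉B₀ : ∀ {k} → k < n → lookup (B₀ k) (k mod n) ≡ false
  k∉B₀ {k} k<n = ≮⇒∉B₀ {y = k mod n} (<-irrefl (toℕ-mod-< k<n))

  count-∩B₀-+1 : ∀ k X → count (X ∩ lookup (B₀ k)) ≤ suc (count ((X +ₚ 1ₙ) ∩ lookup (B₀ k)))
  count-∩B₀-+1 k X = ≤-trans (count-∩-mono-except (pred k) (λ _ → B₀-+1 {k}))
                             (≤-reflexive (cong suc (sym (count-+ₚ-∩ X (lookup (B₀ k)) 1ₙ))))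

  count-∩B₀-+1⁻ : ∀ k X → count ((X +ₚ 1ₙ) ∩ lookup (B₀ k)) ≤ suc (count (X ∩ lookup (B₀ k)))
  count-∩B₀-+1⁻ k X = ≤-trans (≤-reflexive (count-+ₚ-∩ X (lookup (B₀ k)) 1ₙ))
                              (count-∩-mono-except (pred n) (λ _ → B₀-+1⁻ {k}))

  Stab-invariant : (A : Subset n) → ∀ {s} → lookup (Stab A) s ≡ true → lookup A +ₚ s ≗ lookup A
  Stab-invariant A {s} s∈Stab x = begin
    lookup A (x -ₙ s)         ≡⟨ lookup∘tabulate (lookup A +ₚ s) x ⟨
    lookup (translate A s) x  ≡⟨ cong (λ v → lookup v x) translate≡A ⟩
    lookup A x                ∎
    where
    open ≡-Reasoning
    translate≡A : translate A s ≡ A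
    translate≡A = does⇒ (≡-dec _≟ᵇ_ (translate A s) A) (trans (sym (lookup∘tabulate _ s)) s∈Stab)

  -ₚ-Stab⊆fibre : (A : Subset n) → ∀ u y → (u -ₚ lookup (Stab A)) y ≡ true → lookup A y ≡ lookup A u
  -ₚ-Stab⊆fibre A u y u-y∈Stab = trans (cong (lookup A) (sym (-ₙ-involutive u y))) (Stab-invariant A u-y∈Stab u)

  module _ (k : ℕ) (Q P : Fin n → Bool) (A : Subset n)
           (A-def : lookup A ≗ Exchange.A (lookup (B₀ k)) Q P) where

    open Exchange (lookup (B₀ k)) Q P using (count≤1+count-Q+count-P) renaming (A to A′)

    private
      S : Fin n → Bool
      S = lookup (Stab A)

    -ₚ-Stab⊆fibre-A′ : ∀ u {b} → lookup A u ≡ b → ∀ y → (u -ₚ S) y ≡ true → A′ y ≡ b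
    -ₚ-Stab⊆fibre-A′ u Au y e = trans (sym (A-def y)) (trans (-ₚ-Stab⊆fibre A u y e) Au)

    -ₚ-Stab+1⊆fibre-A′ : ∀ u {b} → lookup A (u +ₙ 1ₙ) ≡ b → ∀ y → ((u -ₚ S) +ₚ 1ₙ) y ≡ true → A′ y ≡ b
    -ₚ-Stab+1⊆fibre-A′ u Au+1 y e = -ₚ-Stab⊆fibre-A′ (u +ₙ 1ₙ) Au+1 y (trans (-ₚ-+ₙ u 1ₙ S y) e)

    count-Stab-≤-at-boundary : ∀ u → lookup A u ≢ lookup A (u +ₙ 1ₙ) → count S ≤ suc (count Q + count P)
    count-Stab-≤-at-boundary u Au≢Au+1 with lookup A u in Au | lookup A (u +ₙ 1ₙ) in Au+1
    ... | true  | false = subst (_≤ _) (count--ₚ u S)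
      (count≤1+count-Q+count-P T (T +ₚ 1ₙ) (-ₚ-Stab⊆fibre-A′ u Au) (-ₚ-Stab+1⊆fibre-A′ u Au+1) (count-∩B₀-+1 k T))
      where
      T : Fin n → Bool
      T = u -ₚ S
    ... | false | true  = subst (_≤ _) (trans (count-+ₚ T 1ₙ) (count--ₚ u S))
      (count≤1+count-Q+count-P (T +ₚ 1ₙ) T (-ₚ-Stab+1⊆fibre-A′ u Au+1) (-ₚ-Stab⊆fibre-A′ u Au) (count-∩B₀-+1⁻ k T))
      where
      T : Fin n → Bool
      T = u -ₚ S
    ... | true  | true  = contradiction refl Au≢Au+1
    ... | false | false = contradiction refl Au≢Au+1

    count-Stab-≤ : ∀ {x y} → A′ x ≡ true → A′ y ≡ false → count S ≤ suc (count Q + count P)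
    count-Stab-≤ {x} {y} Ax Ay =
      let (u , Au≢Au+1) = boundary (lookup A) (trans (A-def x) Ax) (trans (A-def y) Ay)
      in  count-Stab-≤-at-boundary u Au≢Au+1

2*n+1≡1+[n+n] : ∀ n → 2 * n + 1 ≡ suc (n + n)
2*n+1≡1+[n+n] n = trans (+-comm (n + (n + 0)) 1) (cong (λ m → suc (n + m)) (+-identityʳ n))

corollary4p5 : (n k : ℕ) .{{_ : NonZero n}} → 2 ≤ n → 1 ≤ k → k ≤ n ∸ 1 →
               (Q P : Subset n) → Q ⊆ B₀ k → P ⊆ ∁ (B₀ k) → ∣ Q ∣ ≡ ∣ P ∣ →
               ∣ Stab ((B₀ k ─ Q) ∪ P) ∣ ≤ 2 * ∣ Q ∣ + 1
-- The hypothesis 2 ≤ n is implied by 1 ≤ k ≤ n ∸ 1.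
corollary4p5 n@(suc _) k _ 1≤k k≤n∸1 Q P Q⊆B₀ P⊆∁B₀ ∣Q∣≡∣P∣ = begin
  ∣ Stab A ∣                                 ≡⟨ ∣p∣≡count-lookup (Stab A) ⟩
  count (lookup (Stab A))                    ≤⟨ count-Stab-≤ k (lookup Q) (lookup P) A (lookup-─∪ (B₀ k) Q P)
                                                             (proj₂ ∃∈A) (proj₂ ∃∉A) ⟩
  suc (count (lookup Q) + count (lookup P))  ≡⟨ cong suc (cong₂ _+_ ∣Q∣≡count-Q ∣Q∣≡count-P) ⟨
  suc (∣ Q ∣ + ∣ Q ∣)                        ≡⟨ 2*n+1≡1+[n+n] ∣ Q ∣ ⟨
  2 * ∣ Q ∣ + 1                              ∎
  where
  open ≤-Reasoning
  open ℤₙ n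
  open Exchange (lookup (B₀ k)) (lookup Q) (lookup P) using (A-nonempty; A-nonfull) renaming (A to A′)

  A : Subset n
  A = (B₀ k ─ Q) ∪ P

  ∣Q∣≡count-Q : ∣ Q ∣ ≡ count (lookup Q)
  ∣Q∣≡count-Q = ∣p∣≡count-lookup Q

  ∣Q∣≡count-P : ∣ Q ∣ ≡ count (lookup P)
  ∣Q∣≡count-P = trans ∣Q∣≡∣P∣ (∣p∣≡count-lookup P)

  ∃∈A : ∃ λ x → A′ x ≡ true
  ∃∈A = A-nonempty 0ₙ (0ₙ∈B₀ 1≤k) (trans (sym ∣Q∣≡count-Q) ∣Q∣≡count-P)

  ∃∉A : ∃ λ y → A′ y ≡ false
  ∃∉A = A-nonfull (k mod n) (k∉B₀ (s≤s k≤n∸1)) (lookup-⊆ Q⊆B₀) (lookup-⊆∁ P⊆∁B₀)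
                  (trans (sym ∣Q∣≡count-Q) ∣Q∣≡count-P)
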